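{- (Law of Quotation.) For every eval-free expression $\mathbf{A}_\alpha$ of $\mathrm{CTT}_{\mathrm{qe}}$, the formula $\ulcorner\mathbf{A}_\alpha\urcorner=\mathcal{E}(\mathbf{A}_\alpha)$ is valid in every model of $\mathrm{CTT}_{\mathrm{qe}}$.
   Context: $\mathrm{CTT}_{\mathrm{qe}}$ is a version of Church's type theory with quotation and evaluation. Types: $\iota$, $o$, $\epsilon$ are types, and if $\alpha,\beta$ are types then $(\alpha\to\beta)$ is a type; $\mathcal{T}$ is the set of types. $\mathcal{V}$ is a set of typed symbols (variables $\mathbf{x}_\alpha$), denumerably many per type; $\mathcal{C}$ is a disjoint set of typed symbols (constants $\mathbf{c}_\alpha$) containing the logical constants $=_{\alpha\to\alpha\to o}$ (every $\alpha$), $\mathrm{is\text{ - }var}_{\epsilon\to o}$, $\mathrm{is\text{ - }con}_{\epsilon\to o}$, $\mathrm{app}_{\epsilon\to\epsilon\to\epsilon}$, $\mathrm{abs}_{\epsilon\to\epsilon\to\epsilon}$, $\mathrm{quo}_{\epsilon\to\epsilon}$, $\mathrm{is\text{ - }expr}^{\alpha}_{\epsilon\to o}$ (every $\alpha$). Expressions: variables and constants; applications $(\mathbf{F}_{\alpha\to\beta}\,\mathbf{A}_\alpha)$ of type $\beta$; abstractions $(\lambda\,\mathbf{x}_\alpha.\mathbf{B}_\beta)$ of type $\alpha\to\beta$; quotations $\ulcorner\mathbf{A}_\alpha\urcorner$ of type $\epsilon$ for eval-free $\mathbf{A}_\alpha$; evaluations $[\![\mathbf{A}_\epsilon]\!]_{\mathbf{B}_\beta}$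 (abbreviated $[\![\mathbf{A}_\epsilon]\!]_\beta$) of type $\beta$. Eval-free means built without the evaluation rule. $(\mathbf{A}_\alpha=\mathbf{B}_\alpha)$ abbreviates $=_{\alpha\to\alpha\to o}\,\mathbf{A}_\alpha\,\mathbf{B}_\alpha$. Constructions: $\ulcorner\mathbf{x}_\alpha\urcorner$, $\ulcorner\mathbf{c}_\alpha\urcorner$ are constructions, and if $\mathbf{A}_\epsilon,\mathbf{B}_\epsilon$ are constructions then so are the expressions $\mathrm{app}\,\mathbf{A}_\epsilon\,\mathbf{B}_\epsilon$, $\mathrm{abs}\,\mathbf{A}_\epsilon\,\mathbf{B}_\epsilon$, $\mathrm{quo}\,\mathbf{A}_\epsilon$. The map $\mathcal{E}$ from eval-free expressions to constructions: $\mathcal{E}(\mathbf{x}_\alpha)=\ulcorner\mathbf{x}_\alpha\urcorner$, $\mathcal{E}(\mathbf{c}_\alpha)=\ulcorner\mathbf{c}_\alpha\urcorner$, $\mathcal{E}(\mathbf{F}\mathbf{A})=\mathrm{app}\,\mathcal{E}(\mathbf{F})\,\mathcal{E}(\mathbf{A})$, $\mathcal{E}(\lambda\mathbf{x}_\alpha.\mathbf{B})=\mathrm{abs}\,\mathcal{E}(\mathbf{x}_\alpha)\,\mathcal{E}(\mathbf{B})$, $\mathcal{E}(\ulcorner\mathbf{A}\urcorner)=\mathrm{quo}\,\mathcal{E}(\mathbf{A})$. Frame: $D_\iota$ nonempty, $D_o=\{\mathrm{T},\mathrm{F}\}$, $D_\epsilon$ = the set of constructions, $D_{\alpha\to\beta}$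 = all total functions $D_\alpha\to D_\beta$. Interpretation: frame plus $I$ on constants with $I(\mathbf{c}_\alpha)\in D_\alpha$, where $I(=_{\alpha\to\alpha\to o})$ is the identity relation on $D_\alpha$; $I(\mathrm{is\text{ - }var})(\mathbf{A})=\mathrm{T}$ iff $\mathbf{A}$ is a quoted variable; $I(\mathrm{is\text{ - }con})(\mathbf{A})=\mathrm{T}$ iff $\mathbf{A}$ is a quoted constant; $I(\mathrm{app})(\mathbf{A})(\mathbf{B})$ is the construction $\mathrm{app}\,\mathbf{A}\,\mathbf{B}$, $I(\mathrm{abs})(\mathbf{A})(\mathbf{B})$ is $\mathrm{abs}\,\mathbf{A}\,\mathbf{B}$, $I(\mathrm{quo})(\mathbf{A})$ is $\mathrm{quo}\,\mathbf{A}$; $I(\mathrm{is\text{ - }expr}^\alpha)(\mathbf{A})=\mathrm{T}$ iff $\mathbf{A}=\mathcal{E}(\mathbf{B}_\alpha)$ for some eval-free $\mathbf{B}_\alpha$. Assignments $\phi$ map variables $\mathbf{x}_\alpha$ into $D_\alpha$. Model: an interpretation $\mathcal{M}$ with a function $V^{\mathcal{M}}$, $V_\phi(\mathbf{C}_\gamma)\in D_\gamma$, satisfying: (1) $V_\phi(\mathbf{x})=\phi(\mathbf{x})$; (2) $V_\phi(\mathbf{c})=I(\mathbf{c})$; (3) $V_\phi(\mathbf{F}\mathbf{A})=V_\phi(\mathbf{F})(V_\phi(\mathbf{A}))$; (4) $V_\phi(\lambda\mathbf{x}_\alpha.\mathbf{B})$ is $d\mapsto V_{\phi[\mathbf{x}_\alpha\mapsto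 d]}(\mathbf{B})$; (5) $V_\phi(\ulcorner\mathbf{A}_\alpha\urcorner)=\mathcal{E}(\mathbf{A}_\alpha)$; (6) if $V_\phi(\mathrm{is\text{ - }expr}^\beta\,\mathbf{A}_\epsilon)=\mathrm{T}$ then $V_\phi([\![\mathbf{A}_\epsilon]\!]_\beta)=V_\phi(\mathcal{E}^{ -1}(V_\phi(\mathbf{A}_\epsilon)))$. A formula $\mathbf{A}_o$ is valid in $\mathcal{M}$ if $V^{\mathcal{M}}_\phi(\mathbf{A}_o)=\mathrm{T}$ for all assignments $\phi$. -}

module Defs where

open import Data.Nat using (ℕ)
import Data.Nat as ℕ
open import Data.Bool using (Bool; true; false)
open import Data.Product using (Σ; _×_; _,_; ∃; ∃-syntax)
open import Relation.Binary.PropositionalEquality using (_≡_; refl; subst)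
open import Relation.Nullary using (Dec; yes; no)
open import Function.Bundles using (_⇔_)

data Ty : Set where
  ι o ε : Ty
  _⇒_   : Ty → Ty → Ty

infixr 5 _⇒_

_≟T_ : (α β : Ty) → Dec (α ≡ β)
ι ≟T ι = yes refl
ι ≟T o = no λ ()
ι ≟T ε = no λ ()
ι ≟T (_ ⇒ _) = no λ ()
o ≟T ι = no λ ()
o ≟T o = yes refl
o ≟T ε = no λ ()
o ≟T (_ ⇒ _) = no λ ()
ε ≟T ι = no λ ()
ε ≟T o = no λ ()
ε ≟T ε = yes refl
ε ≟T (_ ⇒ _) = no λ ()
(_ ⇒ _) ≟T ι = no λ ()
(_ ⇒ _) ≟T o = no λ ()
(_ ⇒ _) ≟T ε = no λ ()
(α ⇒ β) ≟T (α' ⇒ β') with α ≟T α' | β ≟T β'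
... | yes refl | yes refl = yes refl
... | no ne | _ = no λ { refl → ne refl }
... | yes _ | no ne = no λ { refl → ne refl }

-- The language, parameterised by the (arbitrary) family S of
-- non-logical constants of each type.  Variables x_α are pairs
-- (n , α) with n : ℕ (denumerably many per type).

module CTT (S : Ty → Set) where

  data Con : Ty → Set where
    eqC    : (α : Ty) → Con (α ⇒ α ⇒ o)
    isVar  : Con (ε ⇒ o)
    isCon  : Con (ε ⇒ o)
    appC   : Con (ε ⇒ ε ⇒ ε)
    absC   : Con (ε ⇒ ε ⇒ ε)
    quoC   : Con (ε ⇒ ε)
    isExpr : (α : Ty) → Con (ε ⇒ o)
    nl     : ∀ {α} → S α → Con α

  -- Expressions (intrinsically typed) and the eval-free predicate,
  -- defined mutually since quotation only applies to eval-free expressions.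
  data Expr : Ty → Set
  data EvalFree : ∀ {α} → Expr α → Set

  data Expr where
    var  : ℕ → (α : Ty) → Expr α
    con  : ∀ {α} → Con α → Expr α
    app  : ∀ {α β} → Expr (α ⇒ β) → Expr α → Expr β
    lam  : ℕ → (α : Ty) → ∀ {β} → Expr β → Expr (α ⇒ β)
    quo  : ∀ {α} → (A : Expr α) → EvalFree A → Expr ε
    eval : Expr ε → (β : Ty) → Expr β

  data EvalFree where
    ef-var : ∀ {n α} → EvalFree (var n α)
    ef-con : ∀ {α} {c : Con α} → EvalFree (con c)
    ef-app : ∀ {α β} {F : Expr (α ⇒ β)} {A : Expr α} →
             EvalFree F → EvalFree A → EvalFree (app F A)
    ef-lam : ∀ {n α β} {B : Expr β} → EvalFree B → EvalFree (lam n α B)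
    ef-quo : ∀ {α} {A : Expr α} {p : EvalFree A} → EvalFree (quo A p)

  _≐_ : ∀ {α} → Expr α → Expr α → Expr o
  _≐_ {α} A B = app (app (con (eqC α)) A) B

  -- Constructions: the expressions of type ε generated by quoted
  -- variables, quoted constants, app, abs and quo.  We represent them
  -- by a datatype together with its embedding ⌊_⌋ into expressions.
  data Constr : Set where
    cvar : ℕ → Ty → Constr
    ccon : ∀ {α} → Con α → Constr
    capp : Constr → Constr → Constr
    cabs : Constr → Constr → Constr
    cquo : Constr → Constr

  ⌊_⌋ : Constr → Expr ε
  ⌊ cvar n α ⌋ = quo (var n α) ef-var
  ⌊ ccon c ⌋   = quo (con c) ef-con
  ⌊ capp A B ⌋ = app (app (con appC) ⌊ A ⌋) ⌊ B ⌋
  ⌊ cabs A B ⌋ = app (app (con absC) ⌊ A ⌋) ⌊ B ⌋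
  ⌊ cquo A ⌋   = app (con quoC) ⌊ A ⌋

  -- The map ℰ from eval-free expressions to constructions
  -- (as constructions; the expression ℰ(A) is ⌊ ℰ A p ⌋).
  ℰ : ∀ {α} (A : Expr α) → EvalFree A → Constr
  ℰ (var n α) _           = cvar n α
  ℰ (con c) _             = ccon c
  ℰ (app F A) (ef-app p q) = capp (ℰ F p) (ℰ A q)
  ℰ (lam n α B) (ef-lam p) = cabs (cvar n α) (ℰ B p)
  ℰ (quo A p) _           = cquo (ℰ A p)

  isVarC : Constr → Bool
  isVarC (cvar _ _) = true
  isVarC _          = false

  isConC : Constr → Bool
  isConC (ccon _) = true
  isConC _        = false

  D : Set → Ty → Set
  D Dι ι = Dι
  D Dι o = Bool
  D Dι ε = Constr
  D Dι (α ⇒ β) = D Dι α → D Dι β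

  -- Identity of elements of D_α (functions are identical iff they
  -- agree on every argument, as in set theory).
  Same : ∀ {Dι} (α : Ty) → D Dι α → D Dι α → Set
  Same ι d e = d ≡ e
  Same o d e = d ≡ e
  Same ε d e = d ≡ e
  Same (α ⇒ β) f g = ∀ x → Same β (f x) (g x)

  record Interpretation : Set₁ where
    field
      Dι       : Set
      Dι-ne    : Dι
      I        : ∀ {α} → Con α → D Dι α
      I-eq     : ∀ α (d e : D Dι α) → (I (eqC α) d e ≡ true) ⇔ Same α d e
      I-isVar  : ∀ A → I isVar A ≡ isVarC A
      I-isCon  : ∀ A → I isCon A ≡ isConC A
      I-app    : ∀ A B → I appC A B ≡ capp A B
      I-abs    : ∀ A B → I absC A B ≡ cabs A B
      I-quo    : ∀ A → I quoC A ≡ cquo A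
      I-isExpr : ∀ α A → (I (isExpr α) A ≡ true) ⇔
                   (Σ (Expr α) λ B → Σ (EvalFree B) λ p → ℰ B p ≡ A)

  module _ {Dι : Set} where
    Assignment : Set
    Assignment = (n : ℕ) (α : Ty) → D Dι α

    _[_,_↦_] : Assignment → (n : ℕ) (α : Ty) → D Dι α → Assignment
    (φ [ n , α ↦ d ]) m β with n ℕ.≟ m | α ≟T β
    ... | yes _ | yes eq = subst (D Dι) eq d
    ... | yes _ | no _   = φ m β
    ... | no _  | _      = φ m β

  record Model : Set₁ where
    field
      interp : Interpretation
    open Interpretation interp public
    field
      V      : ∀ {γ} → Assignment {Dι} → Expr γ → D Dι γ
      V-var  : ∀ (φ : Assignment {Dι}) n α → Same {Dι} α (V φ (var n α)) (φ n α)
      V-con  : ∀ (φ : Assignment {Dι}) {α} (c : Con α) → Same {Dι} α (V φ (con c)) (I c)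
      V-app  : ∀ (φ : Assignment {Dι}) {α β} (F : Expr (α ⇒ β)) (A : Expr α) →
               Same {Dι} β (V φ (app F A)) (V φ F (V φ A))
      V-lam  : ∀ (φ : Assignment {Dι}) n α {β} (B : Expr β) →
               Same {Dι} (α ⇒ β) (V φ (lam n α B)) (λ d → V (φ [ n , α ↦ d ]) B)
      V-quo  : ∀ (φ : Assignment {Dι}) {α} (A : Expr α) (p : EvalFree A) →
               Same {Dι} ε (V φ (quo A p)) (ℰ A p)
      V-eval : ∀ (φ : Assignment {Dι}) (A : Expr ε) β →
               V φ (app (con (isExpr β)) A) ≡ true →
               (B : Expr β) (p : EvalFree B) → ℰ B p ≡ V φ A →
               Same {Dι} β (V φ (eval A β)) (V φ B)

  Valid : Model → Expr o → Set
  Valid M A = ∀ (φ : Assignment {Model.Dι M}) → Model.V M φ A ≡ true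

module Submission where

open import Defs
open import Data.Bool using (true)
open import Relation.Binary.PropositionalEquality
open import Function.Bundles using (Equivalence)

-- Under any model, a construction read as an expression denotes itself, since
-- app, abs and quo are interpreted as the construction builders.  So ⌜A⌝ and
-- ℰ(A) both denote ℰ A p, and their equation holds because = is interpreted
-- as identity.

data Ground : Ty → Set where
  ground-o : Ground o
  ground-ε : Ground ε

module _ (S : Ty → Set) (M : CTT.Model S) where
  open CTT S
  open Model M
  open ≡-Reasoning

  Same-ground : ∀ {γ} → Ground γ → {d e : D Dι γ} → Same {Dι} γ d e → d ≡ e
  Same-ground ground-o eq = eq
  Same-ground ground-ε eq = eq

  V-con₁ : ∀ φ {α γ} → Ground γ → (c : Con (α ⇒ γ)) (A : Expr α) →
           V φ (app (con c) A) ≡ I c (V φ A)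
  V-con₁ φ g c A = begin
    V φ (app (con c) A)   ≡⟨ Same-ground g (V-app φ (con c) A) ⟩
    V φ (con c) (V φ A)   ≡⟨ Same-ground g (V-con φ c (V φ A)) ⟩
    I c (V φ A)           ∎

  V-con₂ : ∀ φ {α β γ} → Ground γ → (c : Con (α ⇒ β ⇒ γ)) (A : Expr α) (B : Expr β) →
           V φ (app (app (con c) A) B) ≡ I c (V φ A) (V φ B)
  V-con₂ φ g c A B = begin
    V φ (app (app (con c) A) B)   ≡⟨ Same-ground g (V-app φ (app (con c) A) B) ⟩
    V φ (app (con c) A) (V φ B)   ≡⟨ Same-ground g (V-app φ (con c) A (V φ B)) ⟩
    V φ (con c) (V φ A) (V φ B)   ≡⟨ Same-ground g (V-con φ c (V φ A) (V φ B)) ⟩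
    I c (V φ A) (V φ B)           ∎

  V-⌊⌋ : ∀ φ (C : Constr) → V φ ⌊ C ⌋ ≡ C
  V-⌊⌋ φ (cvar n α) = V-quo φ (var n α) ef-var
  V-⌊⌋ φ (ccon c)   = V-quo φ (con c) ef-con
  V-⌊⌋ φ (capp A B) = begin
    V φ ⌊ capp A B ⌋                 ≡⟨ V-con₂ φ ground-ε appC ⌊ A ⌋ ⌊ B ⌋ ⟩
    I appC (V φ ⌊ A ⌋) (V φ ⌊ B ⌋)   ≡⟨ I-app _ _ ⟩
    capp (V φ ⌊ A ⌋) (V φ ⌊ B ⌋)     ≡⟨ cong₂ capp (V-⌊⌋ φ A) (V-⌊⌋ φ B) ⟩
    capp A B                         ∎
  V-⌊⌋ φ (cabs A B) = begin
    V φ ⌊ cabs A B ⌋                 ≡⟨ V-con₂ φ ground-ε absC ⌊ A ⌋ ⌊ B ⌋ ⟩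
    I absC (V φ ⌊ A ⌋) (V φ ⌊ B ⌋)   ≡⟨ I-abs _ _ ⟩
    cabs (V φ ⌊ A ⌋) (V φ ⌊ B ⌋)     ≡⟨ cong₂ cabs (V-⌊⌋ φ A) (V-⌊⌋ φ B) ⟩
    cabs A B                         ∎
  V-⌊⌋ φ (cquo A) = begin
    V φ ⌊ cquo A ⌋        ≡⟨ V-con₁ φ ground-ε quoC ⌊ A ⌋ ⟩
    I quoC (V φ ⌊ A ⌋)    ≡⟨ I-quo _ ⟩
    cquo (V φ ⌊ A ⌋)      ≡⟨ cong cquo (V-⌊⌋ φ A) ⟩
    cquo A                ∎

  V-≐-true : ∀ φ {α} (A B : Expr α) → Same {Dι} α (V φ A) (V φ B) → V φ (A ≐ B) ≡ true
  V-≐-true φ {α} A B same = begin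
    V φ (A ≐ B)                    ≡⟨ V-con₂ φ ground-o (eqC α) A B ⟩
    I (eqC α) (V φ A) (V φ B)      ≡⟨ Equivalence.from (I-eq α _ _) same ⟩
    true                           ∎

  law-of-quotation : ∀ {α} (A : Expr α) (p : EvalFree A) → Valid M (quo A p ≐ ⌊ ℰ A p ⌋)
  law-of-quotation A p φ = V-≐-true φ (quo A p) ⌊ ℰ A p ⌋ (begin
    V φ (quo A p)       ≡⟨ V-quo φ A p ⟩
    ℰ A p               ≡⟨ V-⌊⌋ φ (ℰ A p) ⟨
    V φ ⌊ ℰ A p ⌋       ∎)

theorem1 : (S : Ty → Set) → (M : CTT.Model S) →
    ∀ {α} (A : CTT.Expr S α) (p : CTT.EvalFree S A) →
    CTT.Valid S M (CTT._≐_ S (CTT.quo A p) (CTT.⌊_⌋ S (CTT.ℰ S A p)))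
theorem1 = law-of-quotation
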